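{- There exist cop-win graphs $G$ having an optimal cop strategy that is not a Lower Way strategy.
   Context: All graphs are finite, nonempty and reflexive (every vertex adjacent to itself). For distinct vertices $v,w$ of a graph $H$: $w$ corners $v$ in $H$ if every vertex of $H$ adjacent to $v$ is adjacent to $w$; $w$ strictly corners $v$ in $H$ if moreover some vertex of $H$ adjacent to $w$ is not adjacent to $v$; a strict corner of $H$ is a vertex strictly cornered in $H$ by another vertex. We also say $c$ corners $x$ in $H$ when $c=x$. Corner ranking: $G_1=G$, $k=1$. If $G_k$ is a clique, its vertices get rank $k$; stop. Else if $G_k$ has no strict corners, its vertices get rank $\infty$; stop. Else the set $X$ of strict corners of $G_k$ gets rank $k$, $G_{k+1}=G_k-X$, increase $k$, repeat. $\mathrm{cr}(v)$ is the rank of $v$, $\mathrm{cr}(G)$ the maximum rank. For finite corner rank $\alpha\ge2$: $G$ is $1$-cop-win ($r=1$) if some (equivalently every) vertex of rank $\alpha$ is adjacent to all vertices of $G_{\alpha-1}$, otherwise $0$-cop-win ($r=0$). Projections: $f_k(\{u\})=\{u\}$ if $\mathrm{cr}(u)>k$, otherwise the set of vertices of $G_{k+1}$ that strictly corner $u$ in $G_k$; $f_k(S)=\bigcup_{u\in S}f_k(\{u\})$; $F_1$ the identity, $F_k=f_{k-1}\circ\cdots\circ f_1$, $F_k(v)=F_k(\{v\})$. Game: cop places, robber places, then alternate moves with the cop first; a move is staying or moving to an adjacent vertex; the cop wins when both share a vertex. $G$ is cop-win if the cop can force a win; $\operatorname{capt}(G)$ is the minimum number of cop moves (placement not counted) guaranteeing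 a win. A cop strategy is optimal if it wins in at most $\operatorname{capt}(G)$ cop moves against every robber strategy. With the cop at $c$ and robber at $x$: $x$ is $0$-cornered if $c=x$; for $k\ge1$, $x$ is $k$-cornered by $c$ if some $x'\in F_k(x)$ is cornered by $c$ in the subgraph induced by $V(G_k)\cup\{c\}$. A standard initial placement is a vertex adjacent to every vertex of $G_{\alpha-r}$. A Lower Way strategy has a standard initial placement and, for every $t\ge1$, after $t$ cop moves the cop $k$-corners the robber for some $k\le\alpha-r-t$. -}

module Defs where

open import Data.Nat using (ℕ; zero; suc; _≤_; _<_; _∸_; _<ᵇ_)
open import Data.Fin using (Fin; _≟_)
open import Data.Bool using (Bool; true; false; _∧_; _∨_; not; if_then_else_; T)
open import Data.List using (List; []; _∷_; allFin; foldr)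
open import Data.Bool.ListAction using (all; any)
open import Data.Product using (Σ; _×_; _,_; proj₁)
open import Data.Sum using (_⊎_)
open import Relation.Binary.PropositionalEquality using (_≡_)
open import Relation.Nullary using (¬_)
open import Relation.Nullary.Decidable using (⌊_⌋)

record Graph : Set where
  field
    n      : ℕ
    adj    : Fin (suc n) → Fin (suc n) → Bool
    adj-refl : ∀ v → adj v v ≡ true
    adj-sym  : ∀ v w → adj v w ≡ adj w v

data ℕ∞ : Set where
  fin : ℕ → ℕ∞
  ∞   : ℕ∞

max∞ : ℕ∞ → ℕ∞ → ℕ∞
max∞ ∞ _ = ∞
max∞ (fin _) ∞ = ∞
max∞ (fin a) (fin b) = if a <ᵇ b then fin b else fin a

_<∞ᵇ_ : ℕ → ℕ∞ → Bool
k <∞ᵇ ∞ = true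
k <∞ᵇ fin m = k <ᵇ m

_=fin_ : ℕ∞ → ℕ → Bool
∞ =fin k = false
fin m =fin k = ⌊ m Data.Nat.≟ k ⌋

module _ (G : Graph) where
  open Graph G

  V : Set
  V = Fin (suc n)

  VSet : Set
  VSet = V → Bool

  verts : List V
  verts = allFin (suc n)

  ∀ᵇ : (V → Bool) → Bool
  ∀ᵇ p = all p verts

  ∃ᵇ : (V → Bool) → Bool
  ∃ᵇ p = any p verts

  _==_ : V → V → Bool
  v == w = ⌊ v ≟ w ⌋

  full : VSet
  full _ = true

  single : V → VSet
  single v w = w == v

  cornersᵇ : VSet → V → V → Bool
  cornersᵇ S w v = ∀ᵇ (λ u → not (S u ∧ adj v u) ∨ adj w u)

  strictlyCornersᵇ : VSet → V → V → Bool
  strictlyCornersᵇ S w v =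
    not (w == v) ∧ S w ∧ S v ∧ cornersᵇ S w v
      ∧ ∃ᵇ (λ u → S u ∧ adj w u ∧ not (adj v u))

  strictCornerᵇ : VSet → V → Bool
  strictCornerᵇ S v = ∃ᵇ (λ w → strictlyCornersᵇ S w v)

  hasStrictCornerᵇ : VSet → Bool
  hasStrictCornerᵇ S = ∃ᵇ (strictCornerᵇ S)

  isCliqueᵇ : VSet → Bool
  isCliqueᵇ S = ∀ᵇ (λ v → ∀ᵇ (λ w → not (S v ∧ S w) ∨ adj v w))

  removeStrict : VSet → VSet
  removeStrict S v = S v ∧ not (strictCornerᵇ S v)

  -- iter m = G_{m+1}
  iter : ℕ → VSet
  iter zero = full
  iter (suc m) = removeStrict (iter m)

  -- Gk k = G_k for k ≥ 1; convention G_0 = G_1 = G.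
  Gk : ℕ → VSet
  Gk k = iter (k ∸ 1)

  -- Corner ranking, run with fuel (suc (suc n)), which is sufficient:
  -- each non-stopping step removes ≥ 1 vertex and never empties the graph.
  rk : ℕ → ℕ → VSet → V → ℕ∞
  rk zero k S v = ∞
  rk (suc f) k S v =
    if isCliqueᵇ S then fin k
    else (if hasStrictCornerᵇ S
          then (if strictCornerᵇ S v then fin k else rk f (suc k) (removeStrict S) v)
          else ∞)

  cr : V → ℕ∞
  cr v = rk (suc (suc n)) 1 full v

  crG : ℕ∞
  crG = foldr (λ v acc → max∞ (cr v) acc) (fin 0) verts

  rbit : ℕ → ℕ
  rbit α = if ∃ᵇ (λ v → (cr v =fin α) ∧ ∀ᵇ (λ u → not (Gk (α ∸ 1) u) ∨ adj v u))
           then 1 else 0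

  fk1 : ℕ → V → VSet
  fk1 k u w = if k <∞ᵇ cr u then w == u
              else (Gk (suc k) w ∧ strictlyCornersᵇ (Gk k) w u)

  fk : ℕ → VSet → VSet
  fk k S w = ∃ᵇ (λ u → S u ∧ fk1 k u w)

  -- Fs m = f_m ∘ ⋯ ∘ f_1  (so F_k = Fs (k-1))
  Fs : ℕ → VSet → VSet
  Fs zero S = S
  Fs (suc m) S = fk (suc m) (Fs m S)

  F : ℕ → V → VSet
  F k v = Fs (k ∸ 1) (single v)

  CornersIn : VSet → V → V → Set
  CornersIn H c x = c ≡ x ⊎ (∀ u → T (H u) → T (adj x u) → T (adj c u))

  KCornered : ℕ → V → V → Set
  KCornered zero c x = c ≡ x
  KCornered (suc j) c x =
    Σ V (λ x' → T (F (suc j) x x') ×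
      CornersIn (λ u → Gk (suc j) u ∨ (u == c)) c x')

  -- A (deterministic, history-dependent) cop strategy: an initial vertex and
  -- a move function from the history [(c_{t-1},r_{t-1}), …, (c_0,r_0)]
  -- (most recent first) to the next cop position.
  record CopStrategy : Set where
    field
      start : V
      move  : List (V × V) → V

  open CopStrategy

  LegalCop : CopStrategy → Set
  LegalCop σ = ∀ c r h → T (adj c (move σ ((c , r) ∷ h)))

  -- a robber play: placement ρ 0 and positions ρ t after the robber's t-th move.
  -- (Against a fixed deterministic cop strategy, quantifying over all robber
  -- strategies is the same as quantifying over all legal robber plays.)
  LegalRobber : (ℕ → V) → Set
  LegalRobber ρ = ∀ t → T (adj (ρ t) (ρ (suc t)))

  hist : CopStrategy → (ℕ → V) → ℕ → List (V × V)
  hist σ ρ zero = (start σ , ρ zero) ∷ []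
  hist σ ρ (suc t) = (move σ (hist σ ρ t) , ρ (suc t)) ∷ hist σ ρ t

  copPos : CopStrategy → (ℕ → V) → ℕ → V
  copPos σ ρ zero = start σ
  copPos σ ρ (suc t) = move σ (hist σ ρ t)

  -- capture occurs with the cop having made t moves: either the cop's t-th
  -- move lands on the robber, or the robber (placement / t-th move) lands on the cop.
  Captured : CopStrategy → (ℕ → V) → ℕ → Set
  Captured σ ρ t = copPos σ ρ t ≡ ρ t
                 ⊎ Σ ℕ (λ s → t ≡ suc s × copPos σ ρ t ≡ ρ s)

  WinsWithin : CopStrategy → ℕ → Set
  WinsWithin σ T' = ∀ ρ → LegalRobber ρ → Σ ℕ (λ t → t ≤ T' × Captured σ ρ t)

  CopWin : Set
  CopWin = Σ CopStrategy (λ σ → LegalCop σ × Σ ℕ (λ T' → WinsWithin σ T'))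

  -- optimal: legal and wins within capt(G) moves, i.e. within some T' that
  -- no legal strategy can beat.
  Optimal : CopStrategy → Set
  Optimal σ = LegalCop σ × Σ ℕ (λ T' → WinsWithin σ T' ×
                (∀ σ' T'' → LegalCop σ' → WinsWithin σ' T'' → T' ≤ T''))

  LowerWay : CopStrategy → Set
  LowerWay σ = Σ ℕ λ α → crG ≡ fin α ×
    ((∀ u → T (Gk (α ∸ rbit α) u) → T (adj (start σ) u)) ×
     (∀ ρ → LegalRobber ρ → ∀ t → 1 ≤ t → (∀ s → s < t → ¬ Captured σ ρ s) →
        Σ ℕ (λ k → k ≤ α ∸ rbit α ∸ t × KCornered k (copPos σ ρ t) (ρ (t ∸ 1)))))

-- Take the tree with edges 0-1, 0-2, 0-4, 1-5, 2-3, 3-6 (the path 5-1-0-2-3-6 with a leaf 4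
-- hanging at 0). Its corner ranks are 1 on the leaves 4, 5, 6, then 2 on 1 and 3, then 3 on
-- the clique {0, 2}; so α = 3, r = 0, and 2 is a standard initial placement. Its capture time
-- is 3. A cop on 2 facing a robber on the leaf 4 can afford to stay put: the robber can only
-- step to 0, and is caught within the remaining two moves anyway. The Lower Way rule, however,
-- demands that after this first move the robber be k-cornered for some k ≤ 2, and from 2 it
-- is not. Both capture-time bounds come from two finite game recursions evaluated on the tree.
module Submission where

open import Defs
open import Data.Bool using (Bool; true; false; _∧_; _∨_; not; if_then_else_; T)
open import Data.Bool.ListAction using (any)
open import Data.Bool.Properties using (T-∧; T-∨; ∨-comm)
open import Data.Empty using (⊥-elim)
open import Data.Fin using (Fin; zero; suc; #_; _≟_)
open import Data.List using (List; []; _∷_; length)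
open import Data.List.Membership.Propositional.Properties using (∈-allFin)
open import Data.List.Relation.Unary.All as All using ()
open import Data.List.Relation.Unary.All.Properties using (all⁺)
open import Data.Nat using (ℕ; zero; suc; _+_; _∸_; _≤_; _<_; z≤n; s≤s; _≤?_)
open import Data.Nat.Properties using (≤-trans; ≰⇒>; <⇒≤; +-suc; +-∸-assoc; m≤m+n; m+n∸m≡n)
open import Data.Product using (Σ; _×_; _,_; proj₁; proj₂)
open import Data.Sum using (_⊎_; inj₁; inj₂)
open import Data.Unit using (tt)
open import Function.Bundles using (Equivalence)
open import Relation.Binary.PropositionalEquality using (_≡_; refl; sym; trans; cong; cong₂; subst; ≡-≟-identity; module ≡-Reasoning)
open import Relation.Nullary using (¬_; yes; no)
open import Relation.Nullary.Decidable using (⌊_⌋; toWitness; fromWitness)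

T-∧⁻ : ∀ {a b} → T (a ∧ b) → T a × T b
T-∧⁻ = Equivalence.to T-∧

T-∨⁻ : ∀ {a b} → T (a ∨ b) → T a ⊎ T b
T-∨⁻ = Equivalence.to T-∨

T-⇒⁻ : ∀ {a b} → T (not a ∨ b) → T a → T b
T-⇒⁻ {true} b _ = b

T-not⁻ : ∀ {a} → T (not a) → ¬ T a
T-not⁻ {false} _ ()

first : {A : Set} → (A → Bool) → A → List A → A
first p d [] = d
first p d (x ∷ xs) = if p x then x else first p d xs

first-satisfies : {A : Set} (p : A → Bool) (d : A) (xs : List A) → T (any p xs) → T (p (first p d xs))
first-satisfies p d (x ∷ xs) h with p x in eq
... | true = subst T (sym eq) tt
... | false = first-satisfies p d xs h

first-preserves : {A : Set} (Q : A → Set) (p : A → Bool) (d : A) (xs : List A) →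
                  (∀ x → T (p x) → Q x) → Q d → Q (first p d xs)
first-preserves Q p d [] _ Qd = Qd
first-preserves Q p d (x ∷ xs) p⇒Q Qd with p x in eq
... | true = p⇒Q x (subst T (sym eq) tt)
... | false = first-preserves Q p d xs p⇒Q Qd

module Game (G : Graph) where
  open Graph G using (adj; adj-refl)

  infix 4 _≡ᵇ_
  _≡ᵇ_ : V G → V G → Bool
  _≡ᵇ_ = _==_ G

  ∀ᵇ-elim : (p : V G → Bool) → T (∀ᵇ G p) → ∀ v → T (p v)
  ∀ᵇ-elim p h v = All.lookup (all⁺ p (verts G) h) (∈-allFin v)

  adj-reflᵀ : ∀ v → T (adj v v)
  adj-reflᵀ v = subst T (sym (adj-refl v)) tt

  hist-length : (σ : CopStrategy G) (ρ : ℕ → V G) → ∀ t → length (hist G σ ρ t) ≡ suc t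
  hist-length σ ρ zero = refl
  hist-length σ ρ (suc t) = cong suc (hist-length σ ρ t)

  module Pursuit where

    -- catches j c r: the cop on c, to move, can force capture of the robber on r within j moves.
    catches : ℕ → V G → V G → Bool
    secures : ℕ → V G → V G → Bool
    answers : ℕ → V G → V G → V G → Bool

    goodMove : ℕ → V G → V G → V G → Bool
    goodMove j c r c′ = adj c c′ ∧ secures j c′ r

    catches zero c r = false
    catches (suc j) c r = ∃ᵇ G (goodMove j c r)

    secures j c′ r = (c′ ≡ᵇ r) ∨ ∀ᵇ G (answers j c′ r)

    answers j c′ r r′ = not (adj r r′) ∨ ((c′ ≡ᵇ r′) ∨ catches j c′ r′)

    -- Listing c first makes the cop stay put whenever that is a good move.
    lazyMove : ℕ → V G → V G → V G
    lazyMove j c r = first (goodMove j c r) c (c ∷ verts G)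

    lazyMove-good : ∀ j c r → T (catches (suc j) c r) → T (goodMove j c r (lazyMove j c r))
    lazyMove-good j c r h =
      first-satisfies (goodMove j c r) c (c ∷ verts G) (Equivalence.from (T-∨ {goodMove j c r c}) (inj₂ h))

    lazyMove-adj : ∀ j c r → T (adj c (lazyMove j c r))
    lazyMove-adj j c r =
      first-preserves (λ c′ → T (adj c c′)) (goodMove j c r) c (c ∷ verts G)
        (λ c′ g → proj₁ (T-∧⁻ {adj c c′} g)) (adj-reflᵀ c)

    -- The budget of the move is read off the length of the history; the empty history never occurs.
    lazyCop : ℕ → V G → CopStrategy G
    lazyCop K s = record { start = s ; move = moveOn }
      where
      moveOn : List (V G × V G) → V G
      moveOn [] = s
      moveOn ((c , r) ∷ h) = lazyMove (K ∸ suc (length h)) c r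

    lazyCop-legal : ∀ K s → LegalCop G (lazyCop K s)
    lazyCop-legal K s c r h = lazyMove-adj (K ∸ suc (length h)) c r

    module _ (K : ℕ) (s : V G) (ρ : ℕ → V G) (ρ-legal : LegalRobber G ρ) where

      cop : ℕ → V G
      cop = copPos G (lazyCop K s) ρ

      cop-step : ∀ t → cop (suc t) ≡ lazyMove (K ∸ suc t) (cop t) (ρ t)
      cop-step zero = refl
      cop-step (suc t) =
        cong (λ l → lazyMove (K ∸ suc l) (cop (suc t)) (ρ (suc t))) (hist-length (lazyCop K s) ρ t)

      catches-captures : ∀ j t → t + j ≡ K → T (catches j (cop t) (ρ t)) →
                         Σ ℕ (λ u → u ≤ K × Captured G (lazyCop K s) ρ u)
      catches-captures (suc j) t t+j≡K h = respond (T-∨⁻ {cop (suc t) ≡ᵇ ρ t} secured)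
        where
        open ≡-Reasoning
        budget : K ∸ suc t ≡ j
        budget = begin
          K ∸ suc t           ≡⟨ cong (_∸ suc t) (sym t+j≡K) ⟩
          t + suc j ∸ suc t   ≡⟨ cong (_∸ suc t) (+-suc t j) ⟩
          t + j ∸ t           ≡⟨ m+n∸m≡n t j ⟩
          j                   ∎

        moved : cop (suc t) ≡ lazyMove j (cop t) (ρ t)
        moved = trans (cop-step t) (cong (λ b → lazyMove b (cop t) (ρ t)) budget)

        secured : T (secures j (cop (suc t)) (ρ t))
        secured = proj₂ (T-∧⁻ {adj (cop t) (cop (suc t))}
          (subst (λ c′ → T (goodMove j (cop t) (ρ t) c′)) (sym moved) (lazyMove-good j (cop t) (ρ t) h)))

        next≤K : suc t ≤ K
        next≤K = subst (suc t ≤_) (trans (sym (+-suc t j)) t+j≡K) (s≤s (m≤m+n t j))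

        respond : T (cop (suc t) ≡ᵇ ρ t) ⊎ T (∀ᵇ G (answers j (cop (suc t)) (ρ t))) →
                  Σ ℕ (λ u → u ≤ K × Captured G (lazyCop K s) ρ u)
        respond (inj₁ onRobber) = suc t , next≤K , inj₂ (t , refl , toWitness onRobber)
        respond (inj₂ replies)
          with T-∨⁻ {cop (suc t) ≡ᵇ ρ (suc t)}
                 (T-⇒⁻ {adj (ρ t) (ρ (suc t))} (∀ᵇ-elim _ replies (ρ (suc t))) (ρ-legal t))
        ... | inj₁ meets = suc t , next≤K , inj₁ (toWitness meets)
        ... | inj₂ later = catches-captures j (suc t) (trans (sym (+-suc t j)) t+j≡K) later

    lazyCop-wins : ∀ K s → T (∀ᵇ G (λ r → (s ≡ᵇ r) ∨ catches K s r)) → WinsWithin G (lazyCop K s) K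
    lazyCop-wins K s winning ρ ρ-legal with T-∨⁻ {s ≡ᵇ ρ 0} (∀ᵇ-elim _ winning (ρ 0))
    ... | inj₁ onRobber = 0 , z≤n , inj₁ (toWitness onRobber)
    ... | inj₂ h = catches-captures K s ρ ρ-legal K 0 refl h

  module Evasion where

    -- safe j c r: the robber on r is not caught by the cop on c, and, with the cop to move,
    -- survives the next j cop moves.
    evades : ℕ → V G → V G → Bool
    safe : ℕ → V G → V G → Bool
    escapesTo : ℕ → V G → V G → V G → Bool

    evades zero c r = true
    evades (suc j) c r =
      ∀ᵇ G (λ c′ → not (adj c c′) ∨ (not (c′ ≡ᵇ r) ∧ ∃ᵇ G (escapesTo j c′ r)))

    safe j c r = not (c ≡ᵇ r) ∧ evades j c r

    escapesTo j c′ r r′ = adj r r′ ∧ safe j c′ r′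

    module _ (K : ℕ) (survivable : T (∀ᵇ G (λ c → ∃ᵇ G (safe K c))))
             (σ : CopStrategy G) (σ-legal : LegalCop G σ) where
      open CopStrategy σ

      place : V G → V G
      place c = first (safe K c) c (verts G)

      escape : ℕ → V G → V G → V G
      escape j c′ r = first (escapesTo j c′ r) r (verts G)

      play : ℕ → (V G × V G) × List (V G × V G)
      play zero = (start , place start) , []
      play (suc t) = (c′ , escape (K ∸ suc t) c′ (proj₂ (proj₁ (play t)))) , h
        where
        h = proj₁ (play t) ∷ proj₂ (play t)
        c′ = move h

      cop robber : ℕ → V G
      cop t = proj₁ (proj₁ (play t))
      robber t = proj₂ (proj₁ (play t))

      history : ℕ → List (V G × V G)
      history t = proj₁ (play t) ∷ proj₂ (play t)

      hist-play : ∀ t → hist G σ robber t ≡ history t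
      hist-play zero = refl
      hist-play (suc t) = cong (λ h → (move h , robber (suc t)) ∷ h) (hist-play t)

      copPos-play : ∀ t → copPos G σ robber t ≡ cop t
      copPos-play zero = refl
      copPos-play (suc t) = cong move (hist-play t)

      robber-legal : LegalRobber G robber
      robber-legal t =
        first-preserves (λ r′ → T (adj (robber t) r′)) (escapesTo (K ∸ suc t) (cop (suc t)) (robber t))
          (robber t) (verts G) (λ r′ e → proj₁ (T-∧⁻ {adj (robber t) r′} e)) (adj-reflᵀ (robber t))

      escape-step : ∀ t → t < K → T (evades (K ∸ t) (cop t) (robber t)) →
                    T (not (cop (suc t) ≡ᵇ robber t)) × T (safe (K ∸ suc t) (cop (suc t)) (robber (suc t)))
      escape-step t t<K h = notOnRobber , proj₂ (T-∧⁻ {adj (robber t) (robber (suc t))} escaped)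
        where
        evading : T (evades (suc (K ∸ suc t)) (cop t) (robber t))
        evading = subst (λ b → T (evades b (cop t) (robber t))) (+-∸-assoc 1 t<K) h

        reply : T (not (cop (suc t) ≡ᵇ robber t) ∧ ∃ᵇ G (escapesTo (K ∸ suc t) (cop (suc t)) (robber t)))
        reply = T-⇒⁻ {adj (cop t) (cop (suc t))} (∀ᵇ-elim _ evading (cop (suc t)))
                  (σ-legal (cop t) (robber t) (proj₂ (play t)))

        notOnRobber : T (not (cop (suc t) ≡ᵇ robber t))
        notOnRobber = proj₁ (T-∧⁻ {not (cop (suc t) ≡ᵇ robber t)} reply)

        escaped : T (escapesTo (K ∸ suc t) (cop (suc t)) (robber t) (robber (suc t)))
        escaped = first-satisfies _ (robber t) (verts G) (proj₂ (T-∧⁻ {not (cop (suc t) ≡ᵇ robber t)} reply))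

      invariant : ∀ t → t ≤ K → T (safe (K ∸ t) (cop t) (robber t))
      evades-before : ∀ t → t < K → T (evades (K ∸ t) (cop t) (robber t))

      invariant zero _ = first-satisfies _ start (verts G) (∀ᵇ-elim _ survivable start)
      invariant (suc t) t<K = proj₂ (escape-step t t<K (evades-before t t<K))

      evades-before t t<K = proj₂ (T-∧⁻ {not (cop t ≡ᵇ robber t)} (invariant t (<⇒≤ t<K)))

      not-captured : ∀ u → u ≤ K → ¬ Captured G σ robber u
      not-captured u u≤K (inj₁ caught) =
        T-not⁻ (proj₁ (T-∧⁻ {not (cop u ≡ᵇ robber u)} (invariant u u≤K)))
          (fromWitness (trans (sym (copPos-play u)) caught))
      not-captured (suc t) t<K (inj₂ (.t , refl , caught)) =
        T-not⁻ (proj₁ (escape-step t t<K (evades-before t t<K)))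
          (fromWitness (trans (sym (copPos-play (suc t))) caught))

    capture-time-lower-bound : ∀ K → T (∀ᵇ G (λ c → ∃ᵇ G (safe K c))) →
                               ∀ σ T′ → LegalCop G σ → WinsWithin G σ T′ → suc K ≤ T′
    capture-time-lower-bound K survivable σ T′ σ-legal wins
      with wins (robber K survivable σ σ-legal) (robber-legal K survivable σ σ-legal)
    ... | u , u≤T′ , caught with u ≤? K
    ...   | yes u≤K = ⊥-elim (not-captured K survivable σ σ-legal u u≤K caught)
    ...   | no u≰K = ≤-trans (≰⇒> u≰K) u≤T′

parent : Fin 7 → Fin 7
parent zero = # 0
parent (suc zero) = # 0
parent (suc (suc zero)) = # 0
parent (suc (suc (suc zero))) = # 2
parent (suc (suc (suc (suc zero)))) = # 0
parent (suc (suc (suc (suc (suc zero))))) = # 1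
parent (suc (suc (suc (suc (suc (suc zero)))))) = # 3

treeAdj : Fin 7 → Fin 7 → Bool
treeAdj v w = ⌊ v ≟ w ⌋ ∨ (⌊ parent v ≟ w ⌋ ∨ ⌊ parent w ≟ v ⌋)

⌊≟⌋-sym : ∀ {m} (v w : Fin m) → ⌊ v ≟ w ⌋ ≡ ⌊ w ≟ v ⌋
⌊≟⌋-sym v w with v ≟ w | w ≟ v
... | yes _ | yes _ = refl
... | no _ | no _ = refl
... | yes v≡w | no w≢v = ⊥-elim (w≢v (sym v≡w))
... | no v≢w | yes w≡v = ⊥-elim (v≢w (sym w≡v))

Tree : Graph
Tree = record
  { n = 6
  ; adj = treeAdj
  ; adj-refl = λ v → cong (λ d → ⌊ d ⌋ ∨ (⌊ parent v ≟ v ⌋ ∨ ⌊ parent v ≟ v ⌋)) (≡-≟-identity _≟_ {v} refl)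
  ; adj-sym = λ v w → cong₂ _∨_ (⌊≟⌋-sym v w) (∨-comm (⌊ parent v ≟ w ⌋) (⌊ parent w ≟ v ⌋))
  }

open Game Tree
open Pursuit using (lazyCop; lazyCop-legal; lazyCop-wins)
open Evasion using (capture-time-lower-bound)

lazy : CopStrategy Tree
lazy = lazyCop 3 (# 2)

lazy-wins : WinsWithin Tree lazy 3
lazy-wins = lazyCop-wins 3 (# 2) tt

capture-time≥3 : ∀ σ T′ → LegalCop Tree σ → WinsWithin Tree σ T′ → 3 ≤ T′
capture-time≥3 = capture-time-lower-bound 2 tt

robberOnLeaf : ℕ → V Tree
robberOnLeaf _ = # 4

lazy-stays : copPos Tree lazy robberOnLeaf 1 ≡ # 2
lazy-stays = refl

-- F₁(4) = {4} and F₂(4) = {0}; the cop on 2 sees neither 4 nor the neighbour 1 of 0 in G₂.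
leaf-not-cornered : ∀ k → k ≤ 2 → ¬ KCornered Tree k (# 2) (# 4)
leaf-not-cornered zero _ ()
leaf-not-cornered (suc zero) _ (x′ , x′∈F , corners) = not-1-cornered x′ x′∈F corners
  where
  not-1-cornered : ∀ x′ → T (F Tree 1 (# 4) x′) →
                   ¬ CornersIn Tree (λ u → Gk Tree 1 u ∨ (u ≡ᵇ # 2)) (# 2) x′
  not-1-cornered zero () _
  not-1-cornered (suc zero) () _
  not-1-cornered (suc (suc zero)) () _
  not-1-cornered (suc (suc (suc zero))) () _
  not-1-cornered (suc (suc (suc (suc (suc zero))))) () _
  not-1-cornered (suc (suc (suc (suc (suc (suc zero)))))) () _
  not-1-cornered (suc (suc (suc (suc zero)))) _ (inj₁ ())
  not-1-cornered (suc (suc (suc (suc zero)))) _ (inj₂ dominated) with dominated (# 4) tt tt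
  ... | ()
leaf-not-cornered (suc (suc zero)) _ (x′ , x′∈F , corners) = not-2-cornered x′ x′∈F corners
  where
  not-2-cornered : ∀ x′ → T (F Tree 2 (# 4) x′) →
                   ¬ CornersIn Tree (λ u → Gk Tree 2 u ∨ (u ≡ᵇ # 2)) (# 2) x′
  not-2-cornered (suc zero) () _
  not-2-cornered (suc (suc zero)) () _
  not-2-cornered (suc (suc (suc zero))) () _
  not-2-cornered (suc (suc (suc (suc zero)))) () _
  not-2-cornered (suc (suc (suc (suc (suc zero))))) () _
  not-2-cornered (suc (suc (suc (suc (suc (suc zero)))))) () _
  not-2-cornered zero _ (inj₁ ())
  not-2-cornered zero _ (inj₂ dominated) with dominated (# 1) tt tt
  ... | ()
leaf-not-cornered (suc (suc (suc _))) (s≤s (s≤s ()))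

lazy-not-LowerWay : ¬ LowerWay Tree lazy
lazy-not-LowerWay (α , crG≡α , _ , cornering) with crG≡α
... | refl with cornering robberOnLeaf (λ _ → tt) 1 (s≤s z≤n) not-yet-captured
  where
  not-yet-captured : ∀ u → u < 1 → ¬ Captured Tree lazy robberOnLeaf u
  not-yet-captured zero _ (inj₁ ())
  not-yet-captured zero _ (inj₂ (_ , () , _))
  not-yet-captured (suc _) (s≤s ())
...   | k , k≤2 , cornered =
  leaf-not-cornered k k≤2 (subst (λ c → KCornered Tree k c (# 4)) lazy-stays cornered)

theorem7p2 : Σ Graph (λ G → CopWin G × Σ (CopStrategy G) (λ σ → Optimal G σ × ¬ LowerWay G σ))
theorem7p2 =
  Tree ,
  (lazy , lazyCop-legal 3 (# 2) , 3 , lazy-wins) ,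
  lazy ,
  (lazyCop-legal 3 (# 2) , 3 , lazy-wins , capture-time≥3) ,
  lazy-not-LowerWay
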